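{- Let $k\ge1$, let $2k+1\le i<m$ be integers, and let $A\in\mathcal V_{i-1}^k$. Then $(A^{\langle i\rangle})^{\langle m\rangle}=A^{\langle m\rangle}$.
   Context: $\mathcal V_p^k$ denotes the set of $k$-element subsets of $[p]=\{1,\dots,p\}$ independent in the cycle $C_p$ (no two elements cyclically consecutive, $p$ and $1$ being consecutive). For $A\in\mathcal V_p^k$ the core of $A$ is $\mathrm{core}(A)=A\setminus\{1\}$ if $1\in A$, and $\mathrm{core}(A)=A\setminus\{\max A\}$ otherwise. For $B\in\mathcal V_{p-1}^k$, its $p$-clone is $B^{\langle p\rangle}=\mathrm{core}(B)\cup\{p\}\in\mathcal V_p^k$. (Note $A^{\langle i\rangle}\in\mathcal V_i^k\subseteq\mathcal V_{m-1}^k$.) -}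

module Defs where

open import Data.Nat using (ℕ; zero; suc; _<_; _≤_; _⊔_; _≟_; _≤ᵇ_)
open import Data.List using (List; []; _∷_; length; filter; foldr)
open import Data.List.Membership.Propositional using (_∈_)
open import Data.List.Membership.DecPropositional _≟_ using (_∈?_)
open import Data.List.Relation.Unary.All using (All)
open import Data.List.Relation.Unary.Linked using (Linked)
open import Data.Product using (_×_)
open import Data.Sum using (_⊎_)
open import Data.Bool using (if_then_else_)
open import Relation.Nullary using (¬_; ¬?)
open import Relation.Nullary.Decidable using (does)
open import Relation.Binary.PropositionalEquality using (_≡_)
import Data.Nat.Properties

-- Finite sets of naturals are represented canonically as strictly
-- increasing lists (so set equality is list equality).
SetRep : List ℕ → Set
SetRep A = Linked _<_ A

-- adjacency in the cycle C_p on vertex set [p] (p and 1 consecutive)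
Adjacent : ℕ → ℕ → ℕ → Set
Adjacent p x y = (suc x ≡ y) ⊎ (x ≡ p × y ≡ 1)

V : ℕ → ℕ → List ℕ → Set
V p k A =
  SetRep A
  × All (λ x → 1 ≤ x × x ≤ p) A
  × length A ≡ k
  × (∀ x y → x ∈ A → y ∈ A → ¬ Adjacent p x y)

remove : ℕ → List ℕ → List ℕ
remove x = filter (λ y → ¬? (y ≟ x))

maxL : List ℕ → ℕ
maxL = foldr _⊔_ 0

core : List ℕ → List ℕ
core A = if does (1 ∈? A) then remove 1 A else remove (maxL A) A

insert : ℕ → List ℕ → List ℕ
insert x [] = x ∷ []
insert x (y ∷ ys) with x ≟ y
... | Relation.Nullary.yes _ = y ∷ ys
... | Relation.Nullary.no _ = if x ≤ᵇ y then x ∷ y ∷ ys else y ∷ insert x ys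

clone : ℕ → List ℕ → List ℕ
clone p B = insert p (core B)

-- A clone B^⟨p⟩ with p above every element of B is core(B) with p appended;
-- since core(B) never contains 1, taking the core again removes the maximum
-- p and gives back core(B).  Hence core(A^⟨i⟩) = core(A), and the two
-- m-clones, being determined by these cores, agree.
module Submission where

open import Defs
open import Data.Nat using (ℕ; _≤_; _<_; _+_; _*_; _∸_; _≟_; _≤ᵇ_; s≤s; z≤n; NonZero; >-nonZero)
open import Data.Nat.Properties
open import Data.List using (List; []; _∷_; _++_; _∷ʳ_; filter)
open import Data.List.Properties using (++-identityʳ; filter-++; filter-all; filter-reject)
open import Data.List.Relation.Unary.All using (All; []; _∷_)
import Data.List.Relation.Unary.All as All
open import Data.List.Relation.Unary.All.Properties using (filter⁺)
open import Data.List.Membership.Propositional using (_∉_)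
open import Data.List.Membership.Propositional.Properties using (∈-filter⁻; ∈-++⁻)
open import Data.List.Membership.DecPropositional _≟_ using (_∈?_)
open import Data.List.Relation.Unary.Any using (here)
open import Data.Bool using (true; false; T; if_then_else_)
open import Data.Product using (_,_; proj₁; proj₂)
open import Data.Sum using (inj₁; inj₂)
open import Relation.Nullary using (Dec; ¬?; yes; no; does; contradiction)
open import Relation.Nullary.Decidable using (dec-false)
open import Relation.Binary.PropositionalEquality
  using (_≡_; _≢_; refl; sym; cong; subst; module ≡-Reasoning)

insert-greatest : ∀ {x} L → All (_< x) L → insert x L ≡ L ∷ʳ x
insert-greatest [] [] = refl
insert-greatest {x} (y ∷ ys) (y<x ∷ ys<x) with x ≟ y
... | yes refl = contradiction y<x (<-irrefl refl)
... | no _ with x ≤ᵇ y in x≤ᵇy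
...   | true = contradiction (≤ᵇ⇒≤ x y (subst T (sym x≤ᵇy) _)) (<⇒≱ y<x)
...   | false = cong (y ∷_) (insert-greatest ys ys<x)

maxL-greatest : ∀ {x} L → All (_≤ x) L → maxL (L ∷ʳ x) ≡ x
maxL-greatest {x} [] [] = ⊔-identityʳ x
maxL-greatest (y ∷ ys) (y≤x ∷ ys≤x)
  rewrite maxL-greatest ys ys≤x = m≤n⇒m⊔n≡n y≤x

remove-∷ʳ : ∀ {x} L → All (_≢ x) L → remove x (L ∷ʳ x) ≡ L
remove-∷ʳ {x} L L≢x = begin
  filter P? (L ++ x ∷ [])               ≡⟨ filter-++ P? L (x ∷ []) ⟩
  filter P? L ++ filter P? (x ∷ [])     ≡⟨ cong (_++ filter P? (x ∷ [])) (filter-all P? L≢x) ⟩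
  L ++ filter P? (x ∷ [])               ≡⟨ cong (L ++_) (filter-reject P? (λ x≢x → x≢x refl)) ⟩
  L ++ []                               ≡⟨ ++-identityʳ L ⟩
  L                                     ∎
  where
  open ≡-Reasoning
  P? : (y : ℕ) → Dec (y ≢ x)
  P? y = ¬? (y ≟ x)

core-∷ʳ-greatest : ∀ {x} L → 1 < x → 1 ∉ L → All (_< x) L → core (L ∷ʳ x) ≡ L
core-∷ʳ-greatest {x} L 1<x 1∉L L<x = begin
  core (L ∷ʳ x)
    ≡⟨ cong (λ b → if b then remove 1 (L ∷ʳ x) else remove (maxL (L ∷ʳ x)) (L ∷ʳ x))
            (dec-false (1 ∈? (L ∷ʳ x)) 1∉L∷ʳx) ⟩
  remove (maxL (L ∷ʳ x)) (L ∷ʳ x)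
    ≡⟨ cong (λ y → remove y (L ∷ʳ x)) (maxL-greatest L (All.map <⇒≤ L<x)) ⟩
  remove x (L ∷ʳ x)
    ≡⟨ remove-∷ʳ L (All.map <⇒≢ L<x) ⟩
  L ∎
  where
  open ≡-Reasoning
  1∉L∷ʳx : 1 ∉ L ∷ʳ x
  1∉L∷ʳx 1∈ with ∈-++⁻ L 1∈
  ... | inj₁ 1∈L = 1∉L 1∈L
  ... | inj₂ (here 1≡x) = <⇒≢ 1<x 1≡x

core-all : ∀ {P : ℕ → Set} A → All P A → All P (core A)
core-all A PA with does (1 ∈? A)
... | true = filter⁺ _ PA
... | false = filter⁺ _ PA

1∉core : ∀ A → 1 ∉ core A
1∉core A with 1 ∈? A
... | yes _ = λ 1∈ → proj₂ (∈-filter⁻ (λ y → ¬? (y ≟ 1)) {xs = A} 1∈) refl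
... | no 1∉A = λ 1∈ → 1∉A (proj₁ (∈-filter⁻ (λ y → ¬? (y ≟ maxL A)) {xs = A} 1∈))

core-clone : ∀ {p} B → 1 < p → All (_< p) B → core (clone p B) ≡ core B
core-clone B 1<p B<p
  rewrite insert-greatest (core B) (core-all B B<p)
  = core-∷ʳ-greatest (core B) 1<p (1∉core B) (core-all B B<p)

lemma3p3 : (k i m : ℕ) (A : List ℕ) → 1 ≤ k → 2 * k + 1 ≤ i → i < m →
    V (i ∸ 1) k A → clone m (clone i A) ≡ clone m A
lemma3p3 k i m A 1≤k 2k+1≤i _ (_ , A⊆[i-1] , _ , _) =
  cong (insert m) (core-clone A 1<i A<i)
  where
  1<i : 1 < i
  1<i = ≤-trans (s≤s (s≤s z≤n)) (≤-trans (+-monoˡ-≤ 1 (*-monoʳ-≤ 2 1≤k)) 2k+1≤i)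
  instance
    i≢0 : NonZero i
    i≢0 = >-nonZero (<⇒≤ 1<i)
  A<i : All (_< i) A
  A<i = All.map (λ x∈[1,i-1] → m≤pred[n]⇒suc[m]≤n (proj₂ x∈[1,i-1])) A⊆[i-1]
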